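{- Let $n$ be a power of $2$ and $f:[n]\to\{0,1\}$. Then $\Delta I_f\le \log n\cdot\left(4I^-_f-\widehat{f}(\mathbf{e}_1)\right)$.
   Context: $\mathbf{A}_{n,1}$ is the directed graph on $[n]=\{1,\dots,n\}$ with an edge $(x,y)$ whenever $y-x=2^a$ for some integer $a\ge0$. $S^+_f$ (resp. $S^-_f$) is the set of edges $(x,y)$ with $f(x)=0,f(y)=1$ (resp. $f(x)=1,f(y)=0$); $I^+_f:=|S^+_f|/n$, $I^-_f:=|S^-_f|/n$, and $\Delta I_f:=I^+_f-I^-_f$. $\widehat{f}(\mathbf{e}_1):=\frac{1}{n}\sum_{x=1}^{n/2}\big(f(x)-f(x+n/2)\big)$ (equivalently, half the expected value of $f(x)-f(y)$ over a uniformly random pair $(x,y)$ with $y=x+n/2$). $\log$ is base $2$. -}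

module Defs where

open import Data.Nat as ℕ using (ℕ; suc; _+_; _^_; _≡ᵇ_)
open import Data.Nat.Properties using (m^n≢0)
open import Data.Bool using (Bool; true; false; _∧_; not)
open import Data.List using (foldr; List; []; _∷_; map; filter; length; upTo; concatMap)
open import Data.Bool.ListAction using (any)
open import Data.Product using (_×_; _,_; proj₁; proj₂)
open import Data.Integer as ℤ using (ℤ)
open import Data.Rational as ℚ using (ℚ; _/_)
open import Relation.Nullary.Decidable using (does)
open import Relation.Unary using (Decidable)
open import Data.Bool.Properties using ()
open import Relation.Binary.PropositionalEquality using (_≡_)
import Data.Bool as B

range : ℕ → List ℕ
range n = map suc (upTo n)

-- edge predicate of A_{n,1}: y - x = 2^a for some a ≥ 0.
-- (any such a satisfies a < y, since 2^a ≤ y < 2^y, so searching a ∈ {0,…,y-1} is exhaustive)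
isEdge : ℕ → ℕ → Bool
isEdge x y = any (λ a → (x + 2 ^ a) ≡ᵇ y) (upTo y)

edges : ℕ → List (ℕ × ℕ)
edges n = filter (λ e → B.T? (isEdge (proj₁ e) (proj₂ e)))
            (concatMap (λ x → map (λ y → (x , y)) (range n)) (range n))

-- boolean encoding of {0,1}: false = 0, true = 1
S⁺-count : ℕ → (ℕ → Bool) → ℕ
S⁺-count n f = length (filter (λ e → B.T? (not (f (proj₁ e)) ∧ f (proj₂ e))) (edges n))

S⁻-count : ℕ → (ℕ → Bool) → ℕ
S⁻-count n f = length (filter (λ e → B.T? (f (proj₁ e) ∧ not (f (proj₂ e)))) (edges n))

bit : Bool → ℤ
bit false = ℤ.0ℤ
bit true  = ℤ.1ℤ

I⁺ : (n : ℕ) → .{{ℕ.NonZero n}} → (ℕ → Bool) → ℚ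
I⁺ n f = ℤ.+ (S⁺-count n f) / n

I⁻ : (n : ℕ) → .{{ℕ.NonZero n}} → (ℕ → Bool) → ℚ
I⁻ n f = ℤ.+ (S⁻-count n f) / n

ΔI : (n : ℕ) → .{{ℕ.NonZero n}} → (ℕ → Bool) → ℚ
ΔI n f = I⁺ n f ℚ.- I⁻ n f

fhat-e1 : (n : ℕ) → .{{ℕ.NonZero n}} → (ℕ → Bool) → ℚ
fhat-e1 n f = total / n
  where
  h = n ℕ./ 2
  total : ℤ
  total = foldr ℤ._+_ ℤ.0ℤ (map (λ x → bit (f x) ℤ.- bit (f (x + h))) (range h))

2^k-nonzero : ∀ k → ℕ.NonZero (2 ^ k)
2^k-nonzero k = m^n≢0 2 k

-- Group the edges of A_{n,1} (n = 2^k) by their gap 2^a, a < k, and index vertices from 0, writing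
-- G x for the value of f at vertex x + 1. For a fixed gap d = 2^a the signed count of edges
-- Σ (G(x + d) − G x) telescopes, and adding n·f̂(e₁) = Σ_{x<h} (G x − G(x + h)), h = n/2, leaves
-- Σ_{d ≤ x < h} (G x − G(x + h − d)). Since h − d = 2^a + 2^(a+1) + … + 2^(k−2), each of these
-- differences is at most the number of descending edges along the walk from x to x + h − d with
-- these gaps, and the s-th steps of the walks are distinct edges of gap 2^(a+s). So every gap
-- contributes at most |S⁻_f| − n·f̂(e₁), and summing over the k gaps gives
-- n·ΔI_f ≤ k (|S⁻_f| − n·f̂(e₁)): the claim with 1 in place of 4, as |S⁻_f| ≥ 0.
module Submission where

open import Defs
open import Data.Nat using (ℕ; _^_)
open import Data.Bool using (Bool)
open import Data.Integer using (+_)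

module FiniteSums where

  open import Data.Nat as ℕ using (zero; suc)
  import Data.Nat.Properties as ℕ
  open import Data.Integer using (ℤ; 0ℤ; 1ℤ; _+_; _-_; _*_; _≤_; nonNegative)
  import Data.Integer.Properties as ℤ
  open import Data.Integer.Tactic.RingSolver using (solve-∀)
  open import Data.Bool using (true; false; T?)
  open import Data.List using (List; []; _∷_; _++_; map; foldr; filter; length; concatMap; upTo; applyUpTo)
  open import Data.Sum using (inj₁; inj₂)
  open import Relation.Binary.PropositionalEquality

  ∑ : ℕ → (ℕ → ℤ) → ℤ
  ∑ zero    g = 0ℤ
  ∑ (suc L) g = g 0 + ∑ L (λ i → g (suc i))

  syntax ∑ L (λ i → e) = ∑[ i < L ] e

  ∑-cong : ∀ L {g h : ℕ → ℤ} → (∀ i → i ℕ.< L → g i ≡ h i) → ∑ L g ≡ ∑ L h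
  ∑-cong zero    eq = refl
  ∑-cong (suc L) eq = cong₂ _+_ (eq 0 (ℕ.s≤s ℕ.z≤n)) (∑-cong L (λ i i<L → eq (suc i) (ℕ.s≤s i<L)))

  ∑-mono-≤ : ∀ L {g h : ℕ → ℤ} → (∀ i → i ℕ.< L → g i ≤ h i) → ∑ L g ≤ ∑ L h
  ∑-mono-≤ zero    le = ℤ.≤-refl
  ∑-mono-≤ (suc L) le = ℤ.+-mono-≤ (le 0 (ℕ.s≤s ℕ.z≤n)) (∑-mono-≤ L (λ i i<L → le (suc i) (ℕ.s≤s i<L)))

  ∑-zero : ∀ L {g : ℕ → ℤ} → (∀ i → i ℕ.< L → g i ≡ 0ℤ) → ∑ L g ≡ 0ℤ
  ∑-zero zero    eq = refl
  ∑-zero (suc L) eq = cong₂ _+_ (eq 0 (ℕ.s≤s ℕ.z≤n)) (∑-zero L (λ i i<L → eq (suc i) (ℕ.s≤s i<L)))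

  ∑-nonNeg : ∀ L {g : ℕ → ℤ} → (∀ i → 0ℤ ≤ g i) → 0ℤ ≤ ∑ L g
  ∑-nonNeg zero    nn = ℤ.≤-refl
  ∑-nonNeg (suc L) nn = ℤ.+-mono-≤ (nn 0) (∑-nonNeg L (λ i → nn (suc i)))

  ∑-const : ∀ L c → ∑[ i < L ] c ≡ + L * c
  ∑-const zero    c = sym (ℤ.*-zeroˡ c)
  ∑-const (suc L) c = trans (cong (λ x → c + x) (∑-const L c)) (law (+ L) c)
    where
    law : ∀ l c → c + l * c ≡ (1ℤ + l) * c
    law = solve-∀

  ∑-sub : ∀ L (g h : ℕ → ℤ) → ∑[ i < L ] (g i - h i) ≡ ∑ L g - ∑ L h
  ∑-sub zero    g h = refl
  ∑-sub (suc L) g h = trans (cong (λ x → (g 0 - h 0) + x) (∑-sub L _ _)) (law (g 0) (h 0) _ _)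
    where
    law : ∀ a b x y → (a - b) + (x - y) ≡ (a + x) - (b + y)
    law = solve-∀

  ∑-*ʳ : ∀ L (g : ℕ → ℤ) c → ∑ L g * c ≡ ∑[ i < L ] (g i * c)
  ∑-*ʳ zero    g c = ℤ.*-zeroˡ c
  ∑-*ʳ (suc L) g c = trans (ℤ.*-distribʳ-+ c (g 0) _) (cong (λ x → g 0 * c + x) (∑-*ʳ L _ c))

  ∑-split : ∀ A B (g : ℕ → ℤ) → ∑ (A ℕ.+ B) g ≡ ∑ A g + ∑[ i < B ] g (A ℕ.+ i)
  ∑-split zero    B g = sym (ℤ.+-identityˡ _)
  ∑-split (suc A) B g = trans (cong (λ x → g 0 + x) (∑-split A B _)) (sym (ℤ.+-assoc (g 0) _ _))

  ∑-snoc : ∀ L (g : ℕ → ℤ) → ∑ (suc L) g ≡ ∑ L g + g L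
  ∑-snoc L g = begin
    ∑ (suc L) g                   ≡⟨ cong (λ l → ∑ l g) (ℕ.+-comm 1 L) ⟩
    ∑ (L ℕ.+ 1) g                 ≡⟨ ∑-split L 1 g ⟩
    ∑ L g + (g (L ℕ.+ 0) + 0ℤ)    ≡⟨ cong (λ x → ∑ L g + x) (trans (ℤ.+-identityʳ _) (cong g (ℕ.+-identityʳ L))) ⟩
    ∑ L g + g L                   ∎
    where open ≡-Reasoning

  ∑-swap : ∀ A B (g : ℕ → ℕ → ℤ) → ∑[ i < A ] ∑[ j < B ] g i j ≡ ∑[ j < B ] ∑[ i < A ] g i j
  ∑-swap zero    B g = sym (∑-zero B (λ _ _ → refl))
  ∑-swap (suc A) B g = begin
    ∑[ j < B ] g 0 j + ∑[ i < A ] ∑[ j < B ] g (suc i) j  ≡⟨ cong (λ x → ∑[ j < B ] g 0 j + x) (∑-swap A B _) ⟩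
    ∑[ j < B ] g 0 j + ∑[ j < B ] ∑[ i < A ] g (suc i) j  ≡⟨ ∑-+ B ⟩
    ∑[ j < B ] ∑[ i < suc A ] g i j                         ∎
    where
    open ≡-Reasoning
    ∑-+ : ∀ B {g h : ℕ → ℤ} → ∑ B g + ∑ B h ≡ ∑[ j < B ] (g j + h j)
    ∑-+ zero = refl
    ∑-+ (suc B) {g} {h} = trans (law (g 0) (h 0) _ _) (cong (λ x → g 0 + h 0 + x) (∑-+ B))
      where
      law : ∀ a b x y → (a + x) + (b + y) ≡ (a + b) + (x + y)
      law = solve-∀

  ∑-split-≤ : ∀ {A C} (g : ℕ → ℤ) → A ℕ.≤ C → ∑ C g ≡ ∑ A g + ∑[ i < C ℕ.∸ A ] g (A ℕ.+ i)
  ∑-split-≤ {A} {C} g A≤C = trans (cong (λ l → ∑ l g) (sym (ℕ.m+[n∸m]≡n A≤C))) (∑-split A (C ℕ.∸ A) g)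

  ∑-extend : ∀ {A C} {g : ℕ → ℤ} → A ℕ.≤ C → (∀ i → A ℕ.≤ i → g i ≡ 0ℤ) → ∑ A g ≡ ∑ C g
  ∑-extend {A} {C} {g} A≤C vanish = sym (begin
    ∑ C g                                     ≡⟨ ∑-split-≤ g A≤C ⟩
    ∑ A g + ∑[ i < C ℕ.∸ A ] g (A ℕ.+ i)      ≡⟨ cong (λ x → ∑ A g + x) (∑-zero (C ℕ.∸ A) (λ i _ → vanish (A ℕ.+ i) (ℕ.m≤m+n A i))) ⟩
    ∑ A g + 0ℤ                                ≡⟨ ℤ.+-identityʳ _ ⟩
    ∑ A g                                     ∎)
    where open ≡-Reasoning

  ∑-mono-length : ∀ {A C} {g : ℕ → ℤ} → A ℕ.≤ C → (∀ i → 0ℤ ≤ g i) → ∑ A g ≤ ∑ C g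
  ∑-mono-length {A} {C} {g} A≤C nn = begin
    ∑ A g                                     ≤⟨ ℤ.i≤i+j _ _ {{nonNegative (∑-nonNeg (C ℕ.∸ A) (λ i → nn (A ℕ.+ i)))}} ⟩
    ∑ A g + ∑[ i < C ℕ.∸ A ] g (A ℕ.+ i)      ≡⟨ ∑-split-≤ g A≤C ⟨
    ∑ C g                                     ∎
    where open ℤ.≤-Reasoning

  ∑-window-≤ : ∀ p L {N} {g : ℕ → ℤ} → p ℕ.+ L ℕ.≤ N → (∀ i → 0ℤ ≤ g i) → ∑[ i < L ] g (p ℕ.+ i) ≤ ∑ N g
  ∑-window-≤ p L {N} {g} p+L≤N nn = begin
    ∑[ i < L ] g (p ℕ.+ i)              ≤⟨ ℤ.i≤j+i _ _ {{nonNegative (∑-nonNeg p nn)}} ⟩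
    ∑ p g + ∑[ i < L ] g (p ℕ.+ i)      ≡⟨ ∑-split p L g ⟨
    ∑ (p ℕ.+ L) g                       ≤⟨ ∑-mono-length p+L≤N nn ⟩
    ∑ N g                               ∎
    where open ℤ.≤-Reasoning

  ∑-cong-support : ∀ {A C} {g : ℕ → ℤ} → (∀ i → A ℕ.≤ i → g i ≡ 0ℤ) → (∀ i → C ℕ.≤ i → g i ≡ 0ℤ) →
                   ∑ A g ≡ ∑ C g
  ∑-cong-support {A} {C} vanishA vanishC with ℕ.≤-total A C
  ... | inj₁ A≤C = ∑-extend A≤C vanishA
  ... | inj₂ C≤A = sym (∑-extend C≤A vanishC)

  listSum : {A : Set} → List A → (A → ℤ) → ℤ
  listSum xs g = foldr _+_ 0ℤ (map g xs)

  listSum-++ : ∀ {A : Set} (xs ys : List A) g → listSum (xs ++ ys) g ≡ listSum xs g + listSum ys g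
  listSum-++ []       ys g = sym (ℤ.+-identityˡ _)
  listSum-++ (x ∷ xs) ys g = trans (cong (λ s → g x + s) (listSum-++ xs ys g)) (sym (ℤ.+-assoc (g x) _ _))

  listSum-concatMap : ∀ {A B : Set} (h : A → List B) xs g → listSum (concatMap h xs) g ≡ listSum xs (λ x → listSum (h x) g)
  listSum-concatMap h []       g = refl
  listSum-concatMap h (x ∷ xs) g = trans (listSum-++ (h x) _ g) (cong (λ s → listSum (h x) g + s) (listSum-concatMap h xs g))

  listSum-map : ∀ {A B : Set} (h : A → B) xs g → listSum (map h xs) g ≡ listSum xs (λ x → g (h x))
  listSum-map h []       g = refl
  listSum-map h (x ∷ xs) g = cong (λ s → g (h x) + s) (listSum-map h xs g)

  listSum-applyUpTo : ∀ (h : ℕ → ℕ) L g → listSum (applyUpTo h L) g ≡ ∑[ i < L ] g (h i)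
  listSum-applyUpTo h zero    g = refl
  listSum-applyUpTo h (suc L) g = cong (λ s → g (h 0) + s) (listSum-applyUpTo (λ i → h (suc i)) L g)

  listSum-range : ∀ n (g : ℕ → ℤ) → listSum (range n) g ≡ ∑[ i < n ] g (suc i)
  listSum-range n g = trans (listSum-map suc (upTo n) g) (listSum-applyUpTo (λ i → i) n (λ i → g (suc i)))

  listSum-filter : ∀ {A : Set} (b : A → Bool) xs g →
                   listSum (filter (λ x → T? (b x)) xs) g ≡ listSum xs (λ x → bit (b x) * g x)
  listSum-filter b []       g = refl
  listSum-filter b (x ∷ xs) g with b x
  ... | true  = cong₂ _+_ (sym (ℤ.*-identityˡ (g x))) (listSum-filter b xs g)
  ... | false = trans (listSum-filter b xs g) (sym (ℤ.+-identityˡ _))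

  length-filter : ∀ {A : Set} (b : A → Bool) xs → + length (filter (λ x → T? (b x)) xs) ≡ listSum xs (λ x → bit (b x))
  length-filter b []       = refl
  length-filter b (x ∷ xs) with b x
  ... | true  = trans (ℤ.pos-+ 1 _) (cong (λ s → 1ℤ + s) (length-filter b xs))
  ... | false = trans (length-filter b xs) (sym (ℤ.+-identityˡ _))

module EdgesByGap where

  open FiniteSums
  open import Data.Nat as ℕ using (zero; suc; _≡ᵇ_; _<ᵇ_)
  import Data.Nat.Properties as ℕ
  open import Data.Integer using (ℤ; 0ℤ; 1ℤ; _+_; _-_; _*_)
  import Data.Integer.Properties as ℤ
  open import Data.Bool using (true; false; T; T?; _∧_; not)
  open import Data.List using (List; map; concatMap; applyUpTo; filter; length)
  open import Data.Bool.ListAction using (any)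
  open import Data.Product using (_×_; _,_; proj₁; proj₂)
  open import Data.Unit using (tt)
  open import Data.Empty using (⊥-elim)
  open import Relation.Nullary using (¬_)
  open import Function using (_∘_)
  open import Relation.Binary.PropositionalEquality

  bit≡1 : ∀ {b} → T b → bit b ≡ 1ℤ
  bit≡1 {true} _ = refl

  bit≡0 : ∀ {b} → ¬ T b → bit b ≡ 0ℤ
  bit≡0 {false} _  = refl
  bit≡0 {true}  ¬b = ⊥-elim (¬b tt)

  n<2^n : ∀ n → n ℕ.< 2 ^ n
  n<2^n zero    = ℕ.s≤s ℕ.z≤n
  n<2^n (suc n) = ℕ.+-mono-≤-< (ℕ.^-monoʳ-≤ 2 (ℕ.z≤n {n})) (ℕ.<-≤-trans (n<2^n n) (ℕ.m≤m+n _ 0))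

  2^-cancel-< : ∀ {a b} → 2 ^ a ℕ.< 2 ^ b → a ℕ.< b
  2^-cancel-< lt = ℕ.≰⇒> (λ b≤a → ℕ.<⇒≱ lt (ℕ.^-monoʳ-≤ 2 b≤a))

  2^-cancel-≤ : ∀ {a b} → 2 ^ a ℕ.≤ 2 ^ b → a ℕ.≤ b
  2^-cancel-≤ le = ℕ.≮⇒≥ (λ b<a → ℕ.<⇒≱ (ℕ.^-monoʳ-< 2 (ℕ.n<1+n 1) b<a) le)

  2^-injective : ∀ {a b} → 2 ^ a ≡ 2 ^ b → a ≡ b
  2^-injective eq = ℕ.≤-antisym (2^-cancel-≤ (ℕ.≤-reflexive eq)) (2^-cancel-≤ (ℕ.≤-reflexive (sym eq)))

  bit-any : ∀ (P : ℕ → Bool) (h : ℕ → ℕ) L → (∀ a b → T (P (h a)) → T (P (h b)) → a ≡ b) →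
            bit (any P (applyUpTo h L)) ≡ ∑[ a < L ] bit (P (h a))
  bit-any P h zero    unique = refl
  bit-any P h (suc L) unique with P (h 0) in hit₀
  ... | true  = sym (cong (λ s → 1ℤ + s) (∑-zero L (λ a _ → bit≡0 (no-second-hit a))))
    where
    no-second-hit : ∀ a → ¬ T (P (h (suc a)))
    no-second-hit a hit = ℕ.0≢1+n (unique 0 (suc a) (subst T (sym hit₀) tt) hit)
  ... | false = trans (bit-any P (λ i → h (suc i)) L (λ a b p q → ℕ.suc-injective (unique (suc a) (suc b) p q)))
                      (sym (ℤ.+-identityˡ _))

  isEdge-bit : ∀ k i j → j ℕ.< 2 ^ k → bit (isEdge (suc i) (suc j)) ≡ ∑[ a < k ] bit ((i ℕ.+ 2 ^ a) ≡ᵇ j)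
  isEdge-bit k i j j<2^k = trans (bit-any P (λ a → a) (suc j) unique)
                                 (∑-cong-support (vanishes {suc j} (λ a 2^a≤j → ℕ.s≤s (ℕ.<⇒≤ (ℕ.<-≤-trans (n<2^n a) 2^a≤j))))
                                                 (vanishes {k} (λ a 2^a≤j → 2^-cancel-< (ℕ.≤-<-trans 2^a≤j j<2^k))))
    where
    P : ℕ → Bool
    P a = (i ℕ.+ 2 ^ a) ≡ᵇ j
    i+2^a≡j : ∀ a → T (P a) → i ℕ.+ 2 ^ a ≡ j
    i+2^a≡j a = ℕ.≡ᵇ⇒≡ (i ℕ.+ 2 ^ a) j
    unique : ∀ a b → T (P a) → T (P b) → a ≡ b
    unique a b p q = 2^-injective (ℕ.+-cancelˡ-≡ i _ _ (trans (i+2^a≡j a p) (sym (i+2^a≡j b q))))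
    vanishes : ∀ {A} → (∀ a → 2 ^ a ℕ.≤ j → a ℕ.< A) → ∀ a → A ℕ.≤ a → bit (P a) ≡ 0ℤ
    vanishes bound a A≤a = bit≡0 (λ hit → ℕ.<⇒≱ (bound a (subst (2 ^ a ℕ.≤_) (i+2^a≡j a hit) (ℕ.m≤n+m _ i))) A≤a)

  ∑-≡ᵇ : ∀ n c (H : ℕ → ℤ) → ∑[ j < n ] (bit (c ≡ᵇ j) * H j) ≡ bit (c <ᵇ n) * H c
  ∑-≡ᵇ zero    c       H = refl
  ∑-≡ᵇ (suc n) zero    H = trans (cong (λ s → 1ℤ * H 0 + s) (∑-zero n (λ _ _ → refl))) (ℤ.+-identityʳ _)
  ∑-≡ᵇ (suc n) (suc c) H = trans (ℤ.+-identityˡ _) (∑-≡ᵇ n c (λ j → H (suc j)))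

  ∑-<ᵇ-truncate : ∀ {M d} (G : ℕ → ℤ) → d ℕ.≤ M → ∑[ i < M ] (bit ((i ℕ.+ d) <ᵇ M) * G i) ≡ ∑[ i < M ℕ.∸ d ] G i
  ∑-<ᵇ-truncate {M} {d} G d≤M = begin
    ∑ M H                                 ≡⟨ cong (λ l → ∑ l H) (sym r+d≡M) ⟩
    ∑ (r ℕ.+ d) H                         ≡⟨ ∑-split r d H ⟩
    ∑ r H + ∑[ i < d ] H (r ℕ.+ i)        ≡⟨ cong₂ _+_ (∑-cong r inside) (∑-zero d (λ i _ → outside i)) ⟩
    ∑ r G + 0ℤ                            ≡⟨ ℤ.+-identityʳ _ ⟩
    ∑ r G                                 ∎
    where
    open ≡-Reasoning
    r : ℕ
    r = M ℕ.∸ d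
    r+d≡M : r ℕ.+ d ≡ M
    r+d≡M = ℕ.m∸n+n≡m d≤M
    H : ℕ → ℤ
    H i = bit ((i ℕ.+ d) <ᵇ M) * G i
    inside : ∀ i → i ℕ.< r → H i ≡ G i
    inside i i<r = trans (cong (_* G i) (bit≡1 (ℕ.<⇒<ᵇ (ℕ.m≤o∸n⇒m+n≤o (suc i) d≤M i<r)))) (ℤ.*-identityˡ _)
    outside : ∀ i → H (r ℕ.+ i) ≡ 0ℤ
    outside i = trans (cong (_* G (r ℕ.+ i)) (bit≡0 (λ lt → ℕ.<⇒≱ (ℕ.<ᵇ⇒< ((r ℕ.+ i) ℕ.+ d) M lt) M≤r+i+d)))
                      (ℤ.*-zeroˡ (G (r ℕ.+ i)))
      where
      M≤r+i+d : M ℕ.≤ (r ℕ.+ i) ℕ.+ d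
      M≤r+i+d = subst (ℕ._≤ (r ℕ.+ i) ℕ.+ d) r+d≡M (ℕ.+-monoˡ-≤ d (ℕ.m≤m+n r i))

  ∑-edges : ∀ k (w : ℕ → ℕ → ℤ) →
    ∑[ i < 2 ^ k ] ∑[ j < 2 ^ k ] (bit (isEdge (suc i) (suc j)) * w i j) ≡
    ∑[ a < k ] ∑[ i < 2 ^ k ℕ.∸ 2 ^ a ] w i (i ℕ.+ 2 ^ a)
  ∑-edges k w = begin
    ∑[ i < n ] ∑[ j < n ] (bit (isEdge (suc i) (suc j)) * w i j)
      ≡⟨ ∑-cong n (λ i _ → ∑-cong n (λ j j<n → trans (cong (_* w i j) (isEdge-bit k i j j<n)) (∑-*ʳ k _ (w i j)))) ⟩
    ∑[ i < n ] ∑[ j < n ] ∑[ a < k ] (bit ((i ℕ.+ 2 ^ a) ≡ᵇ j) * w i j)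
      ≡⟨ ∑-cong n (λ i _ → ∑-swap n k _) ⟩
    ∑[ i < n ] ∑[ a < k ] ∑[ j < n ] (bit ((i ℕ.+ 2 ^ a) ≡ᵇ j) * w i j)
      ≡⟨ ∑-cong n (λ i _ → ∑-cong k (λ a _ → ∑-≡ᵇ n (i ℕ.+ 2 ^ a) (w i))) ⟩
    ∑[ i < n ] ∑[ a < k ] (bit ((i ℕ.+ 2 ^ a) <ᵇ n) * w i (i ℕ.+ 2 ^ a))
      ≡⟨ ∑-swap n k _ ⟩
    ∑[ a < k ] ∑[ i < n ] (bit ((i ℕ.+ 2 ^ a) <ᵇ n) * w i (i ℕ.+ 2 ^ a))
      ≡⟨ ∑-cong k (λ a a<k → ∑-<ᵇ-truncate (λ i → w i (i ℕ.+ 2 ^ a)) (ℕ.<⇒≤ (ℕ.^-monoʳ-< 2 (ℕ.n<1+n 1) a<k))) ⟩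
    ∑[ a < k ] ∑[ i < n ℕ.∸ 2 ^ a ] w i (i ℕ.+ 2 ^ a)
      ∎
    where
    open ≡-Reasoning
    n : ℕ
    n = 2 ^ k

  edgeCount-by-gap : ∀ k (b : ℕ × ℕ → Bool) →
    + length (filter (λ e → T? (b e)) (edges (2 ^ k))) ≡
    ∑[ a < k ] ∑[ i < 2 ^ k ℕ.∸ 2 ^ a ] bit (b (suc i , suc (i ℕ.+ 2 ^ a)))
  edgeCount-by-gap k b = begin
    + length (filter (λ e → T? (b e)) (edges n))          ≡⟨ length-filter b (edges n) ⟩
    listSum (edges n) (λ e → bit (b e))                   ≡⟨ listSum-filter (λ e → isEdge (proj₁ e) (proj₂ e)) pairs _ ⟩
    listSum pairs w                                       ≡⟨ listSum-concatMap (λ x → map (x ,_) (range n)) (range n) w ⟩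
    listSum (range n) (λ x → listSum (map (x ,_) (range n)) w)
      ≡⟨ listSum-range n _ ⟩
    ∑[ i < n ] listSum (map (suc i ,_) (range n)) w
      ≡⟨ ∑-cong n (λ i _ → trans (listSum-map (suc i ,_) (range n) w) (listSum-range n _)) ⟩
    ∑[ i < n ] ∑[ j < n ] (bit (isEdge (suc i) (suc j)) * bit (b (suc i , suc j)))
      ≡⟨ ∑-edges k (λ i j → bit (b (suc i , suc j))) ⟩
    ∑[ a < k ] ∑[ i < n ℕ.∸ 2 ^ a ] bit (b (suc i , suc (i ℕ.+ 2 ^ a)))
      ∎
    where
    open ≡-Reasoning
    n : ℕ
    n = 2 ^ k
    pairs : List (ℕ × ℕ)
    pairs = concatMap (λ x → map (x ,_) (range n)) (range n)
    w : ℕ × ℕ → ℤ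
    w e = bit (isEdge (proj₁ e) (proj₂ e)) * bit (b e)

  descents : ℕ → (ℕ → Bool) → ℕ → ℤ
  descents n g e = ∑[ i < n ℕ.∸ e ] bit (g i ∧ not (g (i ℕ.+ e)))

  S⁻-count-by-gap : ∀ k f → + S⁻-count (2 ^ k) f ≡ ∑[ a < k ] descents (2 ^ k) (f ∘ suc) (2 ^ a)
  S⁻-count-by-gap k f = edgeCount-by-gap k (λ e → f (proj₁ e) ∧ not (f (proj₂ e)))

  bit-ascent-descent : ∀ u v → bit (not u ∧ v) - bit (u ∧ not v) ≡ bit v - bit u
  bit-ascent-descent false false = refl
  bit-ascent-descent false true  = refl
  bit-ascent-descent true  false = refl
  bit-ascent-descent true  true  = refl

  ΔS-by-gap : ∀ k f → + S⁺-count (2 ^ k) f - + S⁻-count (2 ^ k) f ≡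
              ∑[ a < k ] ∑[ i < 2 ^ k ℕ.∸ 2 ^ a ] (bit (f (suc (i ℕ.+ 2 ^ a))) - bit (f (suc i)))
  ΔS-by-gap k f = begin
    + S⁺-count n f - + S⁻-count n f
      ≡⟨ cong₂ _-_ (edgeCount-by-gap k (λ e → not (f (proj₁ e)) ∧ f (proj₂ e))) (S⁻-count-by-gap k f) ⟩
    ∑[ a < k ] ∑[ i < n ℕ.∸ 2 ^ a ] ascent a i - ∑[ a < k ] ∑[ i < n ℕ.∸ 2 ^ a ] descent a i
      ≡⟨ ∑-sub k _ _ ⟨
    ∑[ a < k ] (∑[ i < n ℕ.∸ 2 ^ a ] ascent a i - ∑[ i < n ℕ.∸ 2 ^ a ] descent a i)
      ≡⟨ ∑-cong k (λ a _ → ∑-sub (n ℕ.∸ 2 ^ a) _ _) ⟨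
    ∑[ a < k ] ∑[ i < n ℕ.∸ 2 ^ a ] (ascent a i - descent a i)
      ≡⟨ ∑-cong k (λ a _ → ∑-cong (n ℕ.∸ 2 ^ a) (λ i _ → bit-ascent-descent (f (suc i)) (f (suc (i ℕ.+ 2 ^ a))))) ⟩
    ∑[ a < k ] ∑[ i < n ℕ.∸ 2 ^ a ] (bit (f (suc (i ℕ.+ 2 ^ a))) - bit (f (suc i)))
      ∎
    where
    open ≡-Reasoning
    n : ℕ
    n = 2 ^ k
    ascent descent : ℕ → ℕ → ℤ
    ascent  a i = bit (not (f (suc i)) ∧ f (suc (i ℕ.+ 2 ^ a)))
    descent a i = bit (f (suc i) ∧ not (f (suc (i ℕ.+ 2 ^ a))))

module Telescoping where

  open FiniteSums
  open import Data.Nat as ℕ using (zero; suc)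
  import Data.Nat.Properties as ℕ
  open import Data.Integer using (ℤ; _+_; _-_)
  import Data.Integer.Properties as ℤ
  open import Data.Integer.Tactic.RingSolver using (solve-∀)
  open import Relation.Binary.PropositionalEquality

  ∑-shift-telescope : ∀ L d (G : ℕ → ℤ) → ∑[ i < L ] (G (i ℕ.+ d) - G i) ≡ ∑[ i < d ] G (L ℕ.+ i) - ∑ d G
  ∑-shift-telescope zero    d G = sym (ℤ.+-inverseʳ (∑ d G))
  ∑-shift-telescope (suc L) d G = begin
    (G d - G 0) + ∑[ i < L ] (G (suc i ℕ.+ d) - G (suc i))
      ≡⟨ cong (λ s → (G d - G 0) + s) (∑-shift-telescope L d (λ i → G (suc i))) ⟩
    (G d - G 0) + (X - ∑[ i < d ] G (suc i))                 ≡⟨ regroup (G d) (G 0) X _ ⟩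
    X - (G 0 + ∑[ i < d ] G (suc i)) + G d                   ≡⟨ cong (λ s → X - s + G d) (∑-snoc d G) ⟩
    X - (∑ d G + G d) + G d                                  ≡⟨ cancel X (∑ d G) (G d) ⟩
    X - ∑ d G                                                ∎
    where
    open ≡-Reasoning
    X : ℤ
    X = ∑[ i < d ] G (suc L ℕ.+ i)
    regroup : ∀ a b x y → (a - b) + (x - y) ≡ x - (b + y) + a
    regroup = solve-∀
    cancel : ∀ x s a → x - (s + a) + a ≡ x - s
    cancel = solve-∀

  gap-identity : ∀ (G : ℕ → ℤ) {d m h} → d ℕ.+ m ≡ h →
    ∑[ i < h ℕ.+ m ] (G (i ℕ.+ d) - G i) + ∑[ i < h ] (G i - G (i ℕ.+ h)) ≡ ∑[ i < m ] (G (d ℕ.+ i) - G (h ℕ.+ i))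
  gap-identity G {d} {m} refl = begin
    ∑[ i < h ℕ.+ m ] (G (i ℕ.+ d) - G i) + ∑[ i < h ] (G i - G (i ℕ.+ h))
      ≡⟨ cong₂ _+_ (∑-shift-telescope (h ℕ.+ m) d G) (∑-sub h G (λ i → G (i ℕ.+ h))) ⟩
    (W - ∑ d G) + (∑ h G - ∑[ i < h ] G (i ℕ.+ h))
      ≡⟨ cong₂ (λ u v → (W - ∑ d G) + (u - v)) (∑-split d m G) upper ⟩
    (W - ∑ d G) + ((∑ d G + X) - (Y + W))
      ≡⟨ cancel W (∑ d G) X Y ⟩
    X - Y
      ≡⟨ ∑-sub m _ _ ⟨
    ∑[ i < m ] (G (d ℕ.+ i) - G (h ℕ.+ i))
      ∎
    where
    open ≡-Reasoning
    h : ℕ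
    h = d ℕ.+ m
    W X Y : ℤ
    W = ∑[ i < d ] G ((h ℕ.+ m) ℕ.+ i)
    X = ∑[ i < m ] G (d ℕ.+ i)
    Y = ∑[ i < m ] G (h ℕ.+ i)
    cancel : ∀ w v x y → (w - v) + ((v + x) - (y + w)) ≡ x - y
    cancel = solve-∀
    upper : ∑[ i < h ] G (i ℕ.+ h) ≡ Y + W
    upper = begin
      ∑[ i < d ℕ.+ m ] G (i ℕ.+ h)              ≡⟨ ∑-cong h (λ i _ → cong G (ℕ.+-comm i h)) ⟩
      ∑[ i < d ℕ.+ m ] G (h ℕ.+ i)              ≡⟨ cong (λ l → ∑ l (λ i → G (h ℕ.+ i))) (ℕ.+-comm d m) ⟩
      ∑[ i < m ℕ.+ d ] G (h ℕ.+ i)              ≡⟨ ∑-split m d _ ⟩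
      Y + ∑[ i < d ] G (h ℕ.+ (m ℕ.+ i))        ≡⟨ cong (λ s → Y + s) (∑-cong d (λ i _ → cong G (sym (ℕ.+-assoc h m i)))) ⟩
      Y + W                                     ∎

module DescentWalks where

  open FiniteSums
  open EdgesByGap using (descents)
  open import Data.Nat as ℕ using (zero; suc)
  import Data.Nat.Properties as ℕ
  import Data.Nat.Tactic.RingSolver as ℕ-Solver
  open import Data.Integer using (ℤ; 0ℤ; _+_; _-_; _≤_; -≤+; +≤+)
  import Data.Integer.Properties as ℤ
  open import Data.Integer.Tactic.RingSolver using (solve-∀)
  open import Data.Bool using (true; false; _∧_; not)
  open import Relation.Binary.PropositionalEquality

  bit-nonNeg : ∀ b → 0ℤ ≤ bit b
  bit-nonNeg false = ℤ.≤-refl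
  bit-nonNeg true  = +≤+ ℕ.z≤n

  bit-drop≤descent : ∀ u v → bit u - bit v ≤ bit (u ∧ not v)
  bit-drop≤descent false false = ℤ.≤-refl
  bit-drop≤descent false true  = -≤+
  bit-drop≤descent true  false = ℤ.≤-refl
  bit-drop≤descent true  true  = ℤ.≤-refl

  descents-nonNeg : ∀ n g e → 0ℤ ≤ descents n g e
  descents-nonNeg n g e = ∑-nonNeg (n ℕ.∸ e) (λ i → bit-nonNeg (g i ∧ not (g (i ℕ.+ e))))

  drop≤descents : ∀ (g : ℕ → Bool) (p : ℕ → ℕ) t →
    bit (g (p 0)) - bit (g (p t)) ≤ ∑[ s < t ] bit (g (p s) ∧ not (g (p (suc s))))
  drop≤descents g p zero    = ℤ.≤-reflexive (ℤ.+-inverseʳ (bit (g (p 0))))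
  drop≤descents g p (suc t) = begin
    x 0 - x (suc t)                       ≡⟨ split (x 0) (x t) (x (suc t)) ⟩
    (x 0 - x t) + (x t - x (suc t))       ≤⟨ ℤ.+-mono-≤ (drop≤descents g p t) (bit-drop≤descent (g (p t)) (g (p (suc t)))) ⟩
    ∑ t step + step t                     ≡⟨ ∑-snoc t step ⟨
    ∑ (suc t) step                        ∎
    where
    open ℤ.≤-Reasoning
    x : ℕ → ℤ
    x s = bit (g (p s))
    step : ℕ → ℤ
    step s = bit (g (p s) ∧ not (g (p (suc s))))
    split : ∀ a b c → a - c ≡ (a - b) + (b - c)
    split = solve-∀

  ladder : ℕ → ℕ → ℕ
  ladder a zero    = 0
  ladder a (suc t) = ladder a t ℕ.+ 2 ^ (a ℕ.+ t)

  2^suc : ∀ x → 2 ^ suc x ≡ 2 ^ x ℕ.+ 2 ^ x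
  2^suc x = cong (2 ^ x ℕ.+_) (ℕ.+-identityʳ (2 ^ x))

  ladder+2^a : ∀ a t → ladder a t ℕ.+ 2 ^ a ≡ 2 ^ (a ℕ.+ t)
  ladder+2^a a zero    = cong (2 ^_) (sym (ℕ.+-identityʳ a))
  ladder+2^a a (suc t) = begin
    (ladder a t ℕ.+ 2 ^ (a ℕ.+ t)) ℕ.+ 2 ^ a    ≡⟨ swap (ladder a t) (2 ^ (a ℕ.+ t)) (2 ^ a) ⟩
    (ladder a t ℕ.+ 2 ^ a) ℕ.+ 2 ^ (a ℕ.+ t)    ≡⟨ cong (ℕ._+ 2 ^ (a ℕ.+ t)) (ladder+2^a a t) ⟩
    2 ^ (a ℕ.+ t) ℕ.+ 2 ^ (a ℕ.+ t)             ≡⟨ 2^suc (a ℕ.+ t) ⟨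
    2 ^ suc (a ℕ.+ t)                           ≡⟨ cong (2 ^_) (ℕ.+-suc a t) ⟨
    2 ^ (a ℕ.+ suc t)                           ∎
    where
    open ≡-Reasoning
    swap : ∀ x y z → (x ℕ.+ y) ℕ.+ z ≡ (x ℕ.+ z) ℕ.+ y
    swap = ℕ-Solver.solve-∀

  shifted-difference≤descents : ∀ (g : ℕ → Bool) j a → a ℕ.≤ j →
    ∑[ i < 2 ^ j ℕ.∸ 2 ^ a ] (bit (g (2 ^ a ℕ.+ i)) - bit (g (2 ^ j ℕ.+ i))) ≤
    ∑[ b < suc j ] descents (2 ^ suc j) g (2 ^ b)
  shifted-difference≤descents g j a a≤j = begin
    ∑[ i < m ] (bit (g (d ℕ.+ i)) - bit (g (h ℕ.+ i)))
      ≡⟨ ∑-cong m (λ i _ → cong₂ (λ u v → bit (g u) - bit (g v)) (sym (ℕ.+-identityʳ (d ℕ.+ i))) (endpoint i)) ⟩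
    ∑[ i < m ] (bit (g (walk i 0)) - bit (g (walk i T)))
      ≤⟨ ∑-mono-≤ m (λ i _ → drop≤descents g (walk i) T) ⟩
    ∑[ i < m ] ∑[ s < T ] step i s
      ≡⟨ ∑-swap m T step ⟩
    ∑[ s < T ] ∑[ i < m ] step i s
      ≤⟨ ∑-mono-≤ T steps≤descents ⟩
    ∑[ s < T ] descents n g (2 ^ (a ℕ.+ s))
      ≤⟨ ∑-window-≤ a T a+T≤1+j (λ b → descents-nonNeg n g (2 ^ b)) ⟩
    ∑[ b < suc j ] descents n g (2 ^ b)
      ∎
    where
    open ℤ.≤-Reasoning
    d h n T m : ℕ
    d = 2 ^ a
    h = 2 ^ j
    n = 2 ^ suc j
    T = j ℕ.∸ a
    m = h ℕ.∸ d
    walk : ℕ → ℕ → ℕ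
    walk i s = (d ℕ.+ i) ℕ.+ ladder a s
    step : ℕ → ℕ → ℤ
    step i s = bit (g (walk i s) ∧ not (g (walk i (suc s))))
    a+T≡j : a ℕ.+ T ≡ j
    a+T≡j = ℕ.m+[n∸m]≡n a≤j
    a+T≤1+j : a ℕ.+ T ℕ.≤ suc j
    a+T≤1+j = ℕ.≤-trans (ℕ.≤-reflexive a+T≡j) (ℕ.n≤1+n j)
    rearrange : ∀ x y z → (x ℕ.+ y) ℕ.+ z ≡ (z ℕ.+ x) ℕ.+ y
    rearrange = ℕ-Solver.solve-∀
    walk≡ : ∀ i s → walk i s ≡ 2 ^ (a ℕ.+ s) ℕ.+ i
    walk≡ i s = trans (rearrange d i (ladder a s)) (cong (ℕ._+ i) (ladder+2^a a s))
    endpoint : ∀ i → h ℕ.+ i ≡ walk i T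
    endpoint i = sym (trans (walk≡ i T) (cong (λ x → 2 ^ x ℕ.+ i) a+T≡j))
    m≤h : m ℕ.≤ h
    m≤h = ℕ.m∸n≤m h d
    steps≤descents : ∀ s → s ℕ.< T → ∑[ i < m ] step i s ≤ descents n g (2 ^ (a ℕ.+ s))
    steps≤descents s s<T = begin
      ∑[ i < m ] step i s        ≡⟨ ∑-cong m (λ i _ → cong₂ (λ u v → bit (g u ∧ not (g v))) (walk≡ i s) (next i)) ⟩
      ∑[ i < m ] D (e ℕ.+ i)     ≤⟨ ∑-window-≤ e m (ℕ.m+n≤o⇒m≤o∸n (e ℕ.+ m) e+m+e≤n) (λ y → bit-nonNeg _) ⟩
      descents n g e             ∎
      where
      e : ℕ
      e = 2 ^ (a ℕ.+ s)
      D : ℕ → ℤ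
      D y = bit (g y ∧ not (g (y ℕ.+ e)))
      next : ∀ i → walk i (suc s) ≡ (e ℕ.+ i) ℕ.+ e
      next i = trans (sym (ℕ.+-assoc (d ℕ.+ i) (ladder a s) e)) (cong (ℕ._+ e) (walk≡ i s))
      e+e≤h : e ℕ.+ e ℕ.≤ h
      e+e≤h = subst (ℕ._≤ h) (2^suc (a ℕ.+ s))
                (ℕ.^-monoʳ-≤ 2 (subst (a ℕ.+ s ℕ.<_) a+T≡j (ℕ.+-monoʳ-< a s<T)))
      e+m+e≤n : (e ℕ.+ m) ℕ.+ e ℕ.≤ n
      e+m+e≤n = ℕ.≤-trans (ℕ.≤-reflexive (rearrange e m e))
                  (ℕ.≤-trans (ℕ.+-mono-≤ e+e≤h m≤h) (ℕ.≤-reflexive (sym (2^suc j))))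

module CountingInequality where

  open FiniteSums
  open EdgesByGap using (descents; S⁻-count-by-gap; ΔS-by-gap)
  open Telescoping using (gap-identity)
  open DescentWalks using (2^suc; shifted-difference≤descents)
  open import Data.Nat as ℕ using (suc; s≤s)
  import Data.Nat.Properties as ℕ
  open import Data.Nat.DivMod using (m*n/n≡m)
  open import Data.Integer using (ℤ; _+_; _-_; -_; _*_; _≤_; +≤+)
  import Data.Integer.Properties as ℤ
  open import Data.Integer.Tactic.RingSolver using (solve-∀)
  open import Function using (_∘_)
  open import Relation.Binary.PropositionalEquality

  -- fhat-e1 n f unfolds to fhat-numerator n f / n.
  fhat-numerator : ℕ → (ℕ → Bool) → ℤ
  fhat-numerator n f = listSum (range h) (λ x → bit (f x) - bit (f (x ℕ.+ h)))
    where
    h : ℕ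
    h = n ℕ./ 2

  gap+fhat≤S⁻ : ∀ k f a → a ℕ.< k →
    ∑[ i < 2 ^ k ℕ.∸ 2 ^ a ] (bit (f (suc (i ℕ.+ 2 ^ a))) - bit (f (suc i))) + fhat-numerator (2 ^ k) f ≤
    + S⁻-count (2 ^ k) f
  gap+fhat≤S⁻ (suc j) f a (s≤s a≤j) = begin
    ∑[ i < n ℕ.∸ d ] (G (i ℕ.+ d) - G i) + fhat-numerator n f
      ≡⟨ cong₂ _+_ (cong (λ l → ∑[ i < l ] (G (i ℕ.+ d) - G i)) n∸d≡h+m) fhat≡ ⟩
    ∑[ i < h ℕ.+ m ] (G (i ℕ.+ d) - G i) + ∑[ i < h ] (G i - G (i ℕ.+ h))
      ≡⟨ gap-identity G d+m≡h ⟩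
    ∑[ i < m ] (G (d ℕ.+ i) - G (h ℕ.+ i))
      ≤⟨ shifted-difference≤descents (f ∘ suc) j a a≤j ⟩
    ∑[ b < suc j ] descents n (f ∘ suc) (2 ^ b)
      ≡⟨ S⁻-count-by-gap (suc j) f ⟨
    + S⁻-count n f
      ∎
    where
    open ℤ.≤-Reasoning
    n h d m : ℕ
    n = 2 ^ suc j
    h = 2 ^ j
    d = 2 ^ a
    m = h ℕ.∸ d
    G : ℕ → ℤ
    G x = bit (f (suc x))
    d≤h : d ℕ.≤ h
    d≤h = ℕ.^-monoʳ-≤ 2 a≤j
    d+m≡h : d ℕ.+ m ≡ h
    d+m≡h = ℕ.m+[n∸m]≡n d≤h
    n∸d≡h+m : n ℕ.∸ d ≡ h ℕ.+ m
    n∸d≡h+m = trans (cong (ℕ._∸ d) (2^suc j)) (ℕ.+-∸-assoc h d≤h)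
    n/2≡h : n ℕ./ 2 ≡ h
    n/2≡h = trans (cong (ℕ._/ 2) (ℕ.*-comm 2 h)) (m*n/n≡m h 2)
    fhat≡ : fhat-numerator n f ≡ ∑[ i < h ] (G i - G (i ℕ.+ h))
    fhat≡ = trans (listSum-range (n ℕ./ 2) _) (cong (λ l → ∑[ i < l ] (G i - G (i ℕ.+ l))) n/2≡h)

  ΔS≤k[4S⁻-fhat] : ∀ k f →
    + S⁺-count (2 ^ k) f - + S⁻-count (2 ^ k) f ≤ + k * (+ 4 * + S⁻-count (2 ^ k) f - fhat-numerator (2 ^ k) f)
  ΔS≤k[4S⁻-fhat] k f = begin
    + S⁺-count n f - S
      ≡⟨ ΔS-by-gap k f ⟩
    ∑[ a < k ] ∑[ i < n ℕ.∸ 2 ^ a ] (bit (f (suc (i ℕ.+ 2 ^ a))) - bit (f (suc i)))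
      ≤⟨ ∑-mono-≤ k (λ a a<k → move-right (gap+fhat≤S⁻ k f a a<k)) ⟩
    ∑[ a < k ] (S - T)
      ≡⟨ ∑-const k (S - T) ⟩
    + k * (S - T)
      ≤⟨ ℤ.*-monoˡ-≤-nonNeg (+ k) (ℤ.+-monoˡ-≤ (- T) S≤4S) ⟩
    + k * (+ 4 * S - T)
      ∎
    where
    open ℤ.≤-Reasoning
    n : ℕ
    n = 2 ^ k
    S T : ℤ
    S = + S⁻-count n f
    T = fhat-numerator n f
    move-right : ∀ {x} → x + T ≤ S → x ≤ S - T
    move-right {x} x+T≤S = subst (_≤ S - T) (cancel x T) (ℤ.+-monoˡ-≤ (- T) x+T≤S)
      where
      cancel : ∀ x t → x + t - t ≡ x
      cancel = solve-∀
    S≤4S : S ≤ + 4 * S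
    S≤4S = subst (S ≤_) (ℤ.pos-* 4 (S⁻-count n f)) (+≤+ (ℕ.m≤m+n _ _))

open import Data.Rational using (_≤_; _*_; _-_; _/_; -_; toℚᵘ)
import Data.Rational.Properties as ℚ
open import Data.Rational.Unnormalised as ℚᵘ using (mkℚᵘ; *≤*) renaming (_≃_ to _≃ᵘ_; _/_ to _/ᵘ_)
import Data.Rational.Unnormalised.Properties as ℚᵘ
open import Data.Nat as ℕ using (suc)
import Data.Nat.Properties as ℕ
import Data.Integer as ℤ
import Data.Integer.Properties as ℤ
open import Relation.Binary.PropositionalEquality using (_≡_; refl; cong)

toℚᵘ-/ : ∀ p n .{{_ : ℕ.NonZero n}} → toℚᵘ (p / n) ≃ᵘ p /ᵘ n
toℚᵘ-/ p (suc n) = ℚ.toℚᵘ-fromℚᵘ (mkℚᵘ p n)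

/-mono-≤ : ∀ {p q} n .{{_ : ℕ.NonZero n}} → p ℤ.≤ q → p / n ≤ q / n
/-mono-≤ {p} {q} n@(suc _) p≤q = ℚ.toℚᵘ-cancel-≤ (begin
  toℚᵘ (p / n)     ≃⟨ toℚᵘ-/ p n ⟩
  p /ᵘ n           ≤⟨ *≤* (ℤ.*-monoʳ-≤-nonNeg (+ n) p≤q) ⟩
  q /ᵘ n           ≃⟨ toℚᵘ-/ q n ⟨
  toℚᵘ (q / n)     ∎)
  where open ℚᵘ.≤-Reasoning

/-sub : ∀ p q n .{{_ : ℕ.NonZero n}} → (p ℤ.- q) / n ≡ p / n - q / n
/-sub p q n@(suc _) = ℚ.toℚᵘ-injective (begin-equality
  toℚᵘ ((p ℤ.- q) / n)                       ≃⟨ toℚᵘ-/ (p ℤ.- q) n ⟩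
  (p ℤ.- q) /ᵘ n                             ≃⟨ ℚᵘ.*-cancelʳ-/ n ⟨
  ((p ℤ.- q) ℤ.* + n) /ᵘ (n ℕ.* n)           ≡⟨ ℚᵘ./-cong (ℤ.*-distribʳ-+ (+ n) p (ℤ.- q)) refl ⟩
  p /ᵘ n ℚᵘ.- q /ᵘ n                         ≃⟨ ℚᵘ.+-cong (toℚᵘ-/ p n) (ℚᵘ.-‿cong (toℚᵘ-/ q n)) ⟨
  toℚᵘ (p / n) ℚᵘ.- toℚᵘ (q / n)             ≃⟨ ℚᵘ.+-congʳ (toℚᵘ (p / n)) (ℚ.toℚᵘ-homo‿- (q / n)) ⟨
  toℚᵘ (p / n) ℚᵘ.+ toℚᵘ (- (q / n))         ≃⟨ ℚ.toℚᵘ-homo-+ (p / n) _ ⟨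
  toℚᵘ (p / n - q / n)                       ∎)
  where open ℚᵘ.≤-Reasoning

/1-*-/ : ∀ p q n .{{_ : ℕ.NonZero n}} → (p / 1) * (q / n) ≡ (p ℤ.* q) / n
/1-*-/ p q n@(suc _) = ℚ.toℚᵘ-injective (begin-equality
  toℚᵘ ((p / 1) * (q / n))           ≃⟨ ℚ.toℚᵘ-homo-* (p / 1) (q / n) ⟩
  toℚᵘ (p / 1) ℚᵘ.* toℚᵘ (q / n)     ≃⟨ ℚᵘ.*-cong (toℚᵘ-/ p 1) (toℚᵘ-/ q n) ⟩
  (p /ᵘ 1) ℚᵘ.* (q /ᵘ n)             ≡⟨ ℚᵘ./-cong refl (ℕ.*-identityˡ n) ⟩
  (p ℤ.* q) /ᵘ n                     ≃⟨ toℚᵘ-/ (p ℤ.* q) n ⟨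
  toℚᵘ ((p ℤ.* q) / n)               ∎)
  where open ℚᵘ.≤-Reasoning

lemma5p8 : (k : ℕ) (f : ℕ → Bool) →
    ΔI (2 ^ k) {{2^k-nonzero k}} f ≤ (+ k / 1) * ((+ 4 / 1) * I⁻ (2 ^ k) {{2^k-nonzero k}} f - fhat-e1 (2 ^ k) {{2^k-nonzero k}} f)
lemma5p8 k f = begin
  P / n - M / n                                    ≡⟨ /-sub P M n ⟨
  (P ℤ.- M) / n                                    ≤⟨ /-mono-≤ n (ΔS≤k[4S⁻-fhat] k f) ⟩
  (+ k ℤ.* (+ 4 ℤ.* M ℤ.- T)) / n                  ≡⟨ /1-*-/ (+ k) _ n ⟨
  (+ k / 1) * ((+ 4 ℤ.* M ℤ.- T) / n)              ≡⟨ cong ((+ k / 1) *_) (/-sub (+ 4 ℤ.* M) T n) ⟩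
  (+ k / 1) * ((+ 4 ℤ.* M) / n - T / n)            ≡⟨ cong (λ x → (+ k / 1) * (x - T / n)) (/1-*-/ (+ 4) M n) ⟨
  (+ k / 1) * ((+ 4 / 1) * (M / n) - T / n)        ∎
  where
  open CountingInequality using (fhat-numerator; ΔS≤k[4S⁻-fhat])
  open ℚ.≤-Reasoning
  n : ℕ
  n = 2 ^ k
  instance
    2^k≢0 : ℕ.NonZero n
    2^k≢0 = 2^k-nonzero k
  P M T : ℤ.ℤ
  P = + S⁺-count n f
  M = + S⁻-count n f
  T = fhat-numerator n f
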